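{- Let $p$ be a prime and let $\Gamma=\Gamma(D_{2p^2})$ be the intersection graph of $D_{2p^2}$, with vertex sets $H_i$ ($1\le i\le p$), $H_p^i$ ($1\le i\le p$) and $H_{1,p}$ as in the context. For distinct vertices $u,v$ of $\Gamma$: (1) $d(u,v)=1$ if both $u,v$ belong to $H_{1,p}\cup\{H_p^1,\dots,H_p^p\}$, or if $u\in H_i$ and $v=H_p^i$ for some $i$; (2) $d(u,v)=2$ if $u,v\in H_i$ for some $i$, or if $u\in H_j$ and either $v\in H_{1,p}$ or $v=H_p^i$ with $i\neq j$; (3) $d(u,v)=3$ if $u\in H_i$ and $v\in H_j$ with $i\neq j$.
   Context: $D_{2n}=\langle r,s : r^n=s^2=1,\ srs=r^{ -1}\rangle$ is the dihedral group of order $2n$. The intersection graph $\Gamma(G)$ of a finite group $G$ has as vertices the proper non-trivial subgroups of $G$, two distinct vertices being adjacent iff their intersection is non-trivial. For $n=p^2$ the vertex set of $\Gamma(D_{2p^2})$ is the disjoint union of: $H_i=\{\langle sr^{i+lp}\rangle : 1\le l\le p\}$ for $i=1,\dots,p$ (the subgroups of order 2 generated by reflections); the single subgroups $H_p^i=\langle r^p, sr^i\rangle$ for $i=1,\dots,p$; and $H_{1,p}=\{\langle r\rangle,\langle r^p\rangle\}$. $d(u,v)$ denotes graph distance. -}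

module Defs where

open import Data.Nat using (ℕ; zero; suc; _+_; _*_; _∸_; _≤_)
open import Data.Nat.DivMod using (_mod_)
open import Data.Fin using (Fin; toℕ)
open import Data.Bool using (Bool; true; false; _xor_; if_then_else_)
open import Data.Product using (Σ; ∃; _×_; _,_; proj₁)
open import Data.Sum using (_⊎_)
open import Data.List using (List; []; _∷_)
open import Data.List.Relation.Unary.All using (All)
open import Relation.Binary.PropositionalEquality using (_≡_; _≢_)
open import Relation.Nullary using (¬_)

-- The dihedral group D_{2n} with n = suc m.
-- The element  dih e a  represents  s^e r^a  (e : Bool, a : Fin n).
record Dih (m : ℕ) : Set where
  constructor dih
  field
    refl? : Bool
    rot   : Fin (suc m)

module _ {m : ℕ} where

  modN : ℕ → Fin (suc m)
  modN k = k mod (suc m)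

  negN : Fin (suc m) → ℕ
  negN a = suc m ∸ toℕ a

  -- (s^e r^a)(s^f r^b) = s^(e+f) r^((-1)^f a + b)   (using r^a s = s r^(-a))
  mul : Dih m → Dih m → Dih m
  mul (dih e a) (dih f b) =
    dih (e xor f) (modN ((if f then negN a else toℕ a) + toℕ b))

  one : Dih m
  one = dih false (modN 0)

  inv : Dih m → Dih m
  inv (dih false a) = dih false (modN (negN a))
  inv (dih true a)  = dih true a

  r^ : ℕ → Dih m
  r^ k = dih false (modN k)

  sr^ : ℕ → Dih m
  sr^ k = dih true (modN k)

record Subgroup (m : ℕ) : Set where
  field
    mem        : Dih m → Bool
    has-one    : mem one ≡ true
    mul-closed : ∀ x y → mem x ≡ true → mem y ≡ true → mem (mul x y) ≡ true
    inv-closed : ∀ x → mem x ≡ true → mem (inv x) ≡ true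

open Subgroup public

module _ {m : ℕ} where

  _∈ₛ_ : Dih m → Subgroup m → Set
  x ∈ₛ H = mem H x ≡ true

  Proper : Subgroup m → Set
  Proper H = ∃ λ x → ¬ (x ∈ₛ H)

  Nontrivial : Subgroup m → Set
  Nontrivial H = ∃ λ x → x ≢ one × x ∈ₛ H

  IsGeneratedBy : Subgroup m → List (Dih m) → Set
  IsGeneratedBy H gs =
    All (_∈ₛ H) gs × (∀ (K : Subgroup m) → All (_∈ₛ K) gs → ∀ x → x ∈ₛ H → x ∈ₛ K)

Vertex : ℕ → Set
Vertex m = Σ (Subgroup m) λ H → Proper H × Nontrivial H

module _ {m : ℕ} where

  Distinct : Vertex m → Vertex m → Set
  Distinct u v = ∃ λ x → mem (proj₁ u) x ≢ mem (proj₁ v) x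

  Adjacent : Vertex m → Vertex m → Set
  Adjacent u v = Distinct u v × (∃ λ x → x ≢ one × x ∈ₛ proj₁ u × x ∈ₛ proj₁ v)

  data Walk : Vertex m → Vertex m → ℕ → Set where
    here : ∀ {u} → Walk u u 0
    step : ∀ {u w v k} → Adjacent u w → Walk w v k → Walk u v (suc k)

  Dist : Vertex m → Vertex m → ℕ → Set
  Dist u v k = Walk u v k × (∀ j → Walk u v j → k ≤ j)

  -- The named vertex families of Γ(D_{2p^2}) (here n = suc m = p * p).
  -- u ∈ H_i :  u = ⟨ s r^(i + l p) ⟩ for some 1 ≤ l ≤ p
  InH : ℕ → ℕ → Vertex m → Set
  InH p i u = ∃ λ l → 1 ≤ l × l ≤ p × IsGeneratedBy (proj₁ u) (sr^ (i + l * p) ∷ [])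

  IsHp : ℕ → ℕ → Vertex m → Set
  IsHp p i u = IsGeneratedBy (proj₁ u) (r^ p ∷ sr^ i ∷ [])

  InH1p : ℕ → Vertex m → Set
  InH1p p u = IsGeneratedBy (proj₁ u) (r^ 1 ∷ []) ⊎ IsGeneratedBy (proj₁ u) (r^ p ∷ [])

  InA : ℕ → Vertex m → Set
  InA p u = InH1p p u ⊎ (∃ λ i → 1 ≤ i × i ≤ p × IsHp p i u)

-- All of H_{1,p} and every H_p^i contain r^p, and each ⟨s r^k⟩ ∈ H_i (k ≡ i mod p)
-- lies in H_p^i = ⟨r^p, s r^i⟩; this provides all the short paths. Since
-- ⟨s r^k⟩ = {1, s r^k}, it meets a subgroup K non-trivially only if s r^k ∈ K,
-- which gives the lower bounds. For distance 3: a common neighbour of ⟨s r^a⟩ ∈ H_i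
-- and ⟨s r^b⟩ ∈ H_j would contain r^(b−a) with p ∤ b − a, which generates ⟨r⟩
-- since n = p², so it would be the whole group.
module Submission where

open import Defs
open import Data.Bool using (true; false; not)
open import Data.Fin using (Fin; toℕ)
open import Data.Fin.Properties using (toℕ-injective; toℕ-fromℕ<; toℕ<n)
open import Data.List using ([]; _∷_)
open import Data.List.Relation.Unary.All using ([]; _∷_; head)
open import Data.Nat using (ℕ; suc; _+_; _*_; _≤_; _<_; _%_; NonZero; z≤n; s≤s; nonTrivial⇒n>1)
open import Data.Nat.Coprimality using (Coprime; coprime-divisor; coprime-Bézout) renaming (sym to coprime-sym)
open import Data.Nat.Divisibility using (_∣_; divides; ∣-refl; ∣-trans; m%n≡0⇒n∣m; n∣m⇒m%n≡0)
open import Data.Nat.DivMod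
open import Data.Nat.GCD using (module Bézout)
open import Data.Nat.Primality using (Prime; prime⇒irreducible; prime⇒nonZero; prime⇒nonTrivial)
open import Data.Nat.Properties
open import Algebra.Properties.CommutativeSemigroup +-commutativeSemigroup using (x∙yz≈xz∙y; xy∙z≈xz∙y)
open import Data.Nat.Tactic.RingSolver using (solve-∀)
open import Data.Product using (_×_; _,_; proj₁; proj₂)
open import Data.Sum using (inj₁; inj₂)
open import Function using (_∘_)
open import Relation.Nullary using (¬_; Dec; yes; does; contradiction)
open import Relation.Nullary.Decidable using (dec-true)
open import Relation.Binary.PropositionalEquality

dec-true⁻¹ : ∀ {A : Set} (a? : Dec A) → does a? ≡ true → A
dec-true⁻¹ (yes a) _ = a

prime∤⇒coprime : ∀ {p a} → Prime p → ¬ p ∣ a → Coprime p a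
prime∤⇒coprime p-prime p∤a (e∣p , e∣a) with prime⇒irreducible p-prime e∣p
... | inj₁ e≡1 = e≡1
... | inj₂ refl = contradiction e∣a p∤a

coprime-*ˡ : ∀ {a b c} → Coprime a c → Coprime b c → Coprime (a * b) c
coprime-*ˡ {a} a⊥c b⊥c {e} (e∣ab , e∣c) = b⊥c (coprime-divisor e⊥a e∣ab , e∣c)
  where
  e⊥a : Coprime e a
  e⊥a (f∣e , f∣a) = a⊥c (f∣a , ∣-trans f∣e e∣c)

infix 4 _≡_[mod_]
_≡_[mod_] : ℕ → ℕ → (d : ℕ) .{{_ : NonZero d}} → Set
x ≡ y [mod d ] = x % d ≡ y % d

module _ {d : ℕ} .{{_ : NonZero d}} where

  +-cong-mod : ∀ {x x′ y y′} → x ≡ x′ [mod d ] → y ≡ y′ [mod d ] → x + y ≡ x′ + y′ [mod d ]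
  +-cong-mod {x} {x′} {y} {y′} x≡x′ y≡y′ = begin
    (x + y) % d           ≡⟨ %-distribˡ-+ x y d ⟩
    (x % d + y % d) % d   ≡⟨ cong₂ (λ a b → (a + b) % d) x≡x′ y≡y′ ⟩
    (x′ % d + y′ % d) % d ≡⟨ %-distribˡ-+ x′ y′ d ⟨
    (x′ + y′) % d         ∎
    where open ≡-Reasoning

  ∣⇒≡0[mod] : ∀ {x} → d ∣ x → x ≡ 0 [mod d ]
  ∣⇒≡0[mod] {x} d∣x = trans (n∣m⇒m%n≡0 x d d∣x) (sym (m*n%n≡0 0 d))

  ≡0[mod]⇒∣ : ∀ {x} → x ≡ 0 [mod d ] → d ∣ x
  ≡0[mod]⇒∣ {x} x≡0 = m%n≡0⇒n∣m x d (trans x≡0 (m*n%n≡0 0 d))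

  <⇒≢[mod] : ∀ {k} → 1 ≤ k → k < d → ¬ k ≡ d [mod d ]
  <⇒≢[mod] {k} 1≤k k<d k≡d = n>0⇒n≢0 1≤k (trans (sym (m<n⇒m%n≡m k<d)) (trans k≡d (n%n≡0 d)))

  ≡[mod]-injective : ∀ {i j} → 1 ≤ i → i ≤ d → 1 ≤ j → j ≤ d → i ≡ j [mod d ] → i ≡ j
  ≡[mod]-injective {i} {j} 1≤i i≤d 1≤j j≤d i≡j
    with m≤n⇒m<n∨m≡n i≤d | m≤n⇒m<n∨m≡n j≤d
  ... | inj₁ i<d | inj₁ j<d = trans (sym (m<n⇒m%n≡m i<d)) (trans i≡j (m<n⇒m%n≡m j<d))
  ... | inj₁ i<d | inj₂ refl = contradiction i≡j (<⇒≢[mod] 1≤i i<d)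
  ... | inj₂ refl | inj₁ j<d = contradiction (sym i≡j) (<⇒≢[mod] 1≤j j<d)
  ... | inj₂ refl | inj₂ refl = refl

-- The subgroup ⟨r^d, s r^c⟩ of D_{2n} for a divisor d of n: it consists of the
-- elements r^a with a ≡ 0 and s r^a with a ≡ c (mod d).
module Residues {m : ℕ} (d : ℕ) .{{_ : NonZero d}} (d∣n : d ∣ suc m) where

  toℕ-modN-mod : ∀ k → toℕ (modN {m} k) ≡ k [mod d ]
  toℕ-modN-mod k = trans (cong (_% d) (toℕ-fromℕ< _)) (m∣n⇒o%n%m≡o%m d (suc m) k d∣n)

  negN-+-mod0 : (a : Fin (suc m)) → negN a + toℕ a ≡ 0 [mod d ]
  negN-+-mod0 a = trans (cong (_% d) (m∸n+n≡m (<⇒≤ (toℕ<n a)))) (∣⇒≡0[mod] d∣n)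

  negN-mod : ∀ (a : Fin (suc m)) {y z} → z + toℕ a ≡ y [mod d ] → negN a + y ≡ z [mod d ]
  negN-mod a {y} {z} z+a≡y = begin
    (negN a + y) % d           ≡⟨ +-cong-mod {x = negN a} refl (sym z+a≡y) ⟩
    (negN a + (z + toℕ a)) % d ≡⟨ cong (_% d) (x∙yz≈xz∙y (negN a) z (toℕ a)) ⟩
    (negN a + toℕ a + z) % d   ≡⟨ +-cong-mod (negN-+-mod0 a) refl ⟩
    z % d                      ∎
    where open ≡-Reasoning

  negN-+-mod0⇒≡ : (a b : Fin (suc m)) → negN a + toℕ b ≡ 0 [mod d ] → toℕ a ≡ toℕ b [mod d ]
  negN-+-mod0⇒≡ a b b−a≡0 = begin
    toℕ a % d                   ≡⟨ +-cong-mod {x = 0} (sym b−a≡0) refl ⟩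
    (negN a + toℕ b + toℕ a) % d ≡⟨ cong (_% d) (xy∙z≈xz∙y (negN a) (toℕ b) (toℕ a)) ⟩
    (negN a + toℕ a + toℕ b) % d ≡⟨ +-cong-mod (negN-+-mod0 a) refl ⟩
    toℕ b % d                   ∎
    where open ≡-Reasoning

  target : ℕ → Dih m → ℕ
  target c (dih false _) = 0
  target c (dih true _)  = c

  Member : ℕ → Dih m → Set
  Member c x = toℕ (Dih.rot x) ≡ target c x [mod d ]

  member-mul : ∀ c x y → Member c x → Member c y → Member c (mul x y)
  member-mul c (dih false a) (dih false b) a≡0 b≡0 =
    trans (toℕ-modN-mod _) (+-cong-mod a≡0 b≡0)
  member-mul c (dih false a) (dih true b) a≡0 b≡c =
    trans (toℕ-modN-mod _)
          (negN-mod a (trans (+-cong-mod {x = c} refl a≡0) (trans (cong (_% d) (+-identityʳ c)) (sym b≡c))))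
  member-mul c (dih true a) (dih false b) a≡c b≡0 =
    trans (toℕ-modN-mod _) (trans (+-cong-mod a≡c b≡0) (cong (_% d) (+-identityʳ c)))
  member-mul c (dih true a) (dih true b) a≡c b≡c =
    trans (toℕ-modN-mod _) (negN-mod a (trans a≡c (sym b≡c)))

  member-inv : ∀ c x → Member c x → Member c (inv x)
  member-inv c (dih false a) a≡0 =
    trans (toℕ-modN-mod _) (trans (cong (_% d) (sym (+-identityʳ (negN a)))) (negN-mod a a≡0))
  member-inv c (dih true a) a≡c = a≡c

  Member? : ∀ c x → Dec (Member c x)
  Member? c x = toℕ (Dih.rot x) % d ≟ target c x % d

  ⟨r^d,sr^_⟩ : ℕ → Subgroup m
  ⟨r^d,sr^ c ⟩ = record
    { mem        = does ∘ Member? c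
    ; has-one    = dec-true (Member? c one) (toℕ-modN-mod 0)
    ; mul-closed = λ x y x∈ y∈ → dec-true (Member? c (mul x y))
                     (member-mul c x y (dec-true⁻¹ (Member? c x) x∈) (dec-true⁻¹ (Member? c y) y∈))
    ; inv-closed = λ x x∈ → dec-true (Member? c (inv x)) (member-inv c x (dec-true⁻¹ (Member? c x) x∈))
    }

  ∈⇒Member : ∀ c x → x ∈ₛ ⟨r^d,sr^ c ⟩ → Member c x
  ∈⇒Member c x = dec-true⁻¹ (Member? c x)

  Member⇒∈ : ∀ c x → Member c x → x ∈ₛ ⟨r^d,sr^ c ⟩
  Member⇒∈ c x = dec-true (Member? c x)

  r^d∈ : ∀ c → r^ d ∈ₛ ⟨r^d,sr^ c ⟩
  r^d∈ c = Member⇒∈ c (r^ d) (trans (toℕ-modN-mod d) (∣⇒≡0[mod] {x = d} ∣-refl))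

  sr^c∈ : ∀ c → sr^ c ∈ₛ ⟨r^d,sr^ c ⟩
  sr^c∈ c = Member⇒∈ c (sr^ c) (toℕ-modN-mod c)

  sr^∈⇒≡ : ∀ c k → sr^ k ∈ₛ ⟨r^d,sr^ c ⟩ → k ≡ c [mod d ]
  sr^∈⇒≡ c k sr^k∈ = trans (sym (toℕ-modN-mod k)) (∈⇒Member c (sr^ k) sr^k∈)

module _ {m : ℕ} where

  open Residues {m} (suc m) ∣-refl using (toℕ-modN-mod; ⟨r^d,sr^_⟩; ∈⇒Member; sr^c∈)

  _⊆ₛ_ : Subgroup m → Subgroup m → Set
  H ⊆ₛ K = ∀ x → x ∈ₛ H → x ∈ₛ K

  modN-cong : ∀ k l → k ≡ l [mod suc m ] → modN {m} k ≡ modN l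
  modN-cong k l k≡l = toℕ-injective (trans (toℕ-fromℕ< _) (trans k≡l (sym (toℕ-fromℕ< _))))

  modN-toℕ : (t : Fin (suc m)) → modN (toℕ t) ≡ t
  modN-toℕ t = toℕ-injective (trans (toℕ-fromℕ< _) (m<n⇒m%n≡m (toℕ<n t)))

  modN-+ : ∀ a b → modN {m} (toℕ (modN {m} a) + toℕ (modN {m} b)) ≡ modN (a + b)
  modN-+ a b = modN-cong (a′ + b′) (a + b)
    (+-cong-mod {x = a′} {x′ = a} {y = b′} {y′ = b} (toℕ-modN-mod a) (toℕ-modN-mod b))
    where
    a′ b′ : ℕ
    a′ = toℕ (modN {m} a)
    b′ = toℕ (modN {m} b)

  r^-+ : ∀ a b → mul (r^ {m} a) (r^ b) ≡ r^ (a + b)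
  r^-+ a b = cong (dih false) (modN-+ a b)

  sr^-+ : ∀ a b → mul (sr^ {m} a) (r^ b) ≡ sr^ (a + b)
  sr^-+ a b = cong (dih true) (modN-+ a b)

  module _ (H : Subgroup m) where

    r^-*-∈ : ∀ a → r^ a ∈ₛ H → ∀ k → r^ (k * a) ∈ₛ H
    r^-*-∈ a r^a∈ 0       = has-one H
    r^-*-∈ a r^a∈ (suc k) = subst (_∈ₛ H) (r^-+ a (k * a)) (mul-closed H _ _ r^a∈ (r^-*-∈ a r^a∈ k))

    r^-∈ : r^ 1 ∈ₛ H → ∀ k → r^ k ∈ₛ H
    r^-∈ r∈ k = subst (λ j → r^ j ∈ₛ H) (*-identityʳ k) (r^-*-∈ 1 r∈ k)

    -- r^b is the (m = n − 1)-th power of r^a.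
    r^-complement-∈ : ∀ a b → a + b ≡ 0 [mod suc m ] → r^ a ∈ₛ H → r^ b ∈ₛ H
    r^-complement-∈ a b a+b≡0 r^a∈ =
      subst (_∈ₛ H) (cong (dih false) (modN-cong (m * a) b m*a≡b)) (r^-*-∈ a r^a∈ m)
      where
      m*a≡b : m * a ≡ b [mod suc m ]
      m*a≡b = begin
        (m * a) % suc m           ≡⟨ %-remove-+ʳ (m * a) (≡0[mod]⇒∣ a+b≡0) ⟨
        (m * a + (a + b)) % suc m ≡⟨ cong (_% suc m) (m*a+[a+b]≡b+a*n m a b) ⟩
        (b + a * suc m) % suc m   ≡⟨ [m+kn]%n≡m%n b a (suc m) ⟩
        b % suc m                 ∎
        where
        open ≡-Reasoning
        m*a+[a+b]≡b+a*n : ∀ m a b → m * a + (a + b) ≡ b + a * suc m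
        m*a+[a+b]≡b+a*n = solve-∀

    coprime-r^-∈ : ∀ a → Coprime a (suc m) → r^ a ∈ₛ H → r^ 1 ∈ₛ H
    coprime-r^-∈ a a⊥n r^a∈ with coprime-Bézout a⊥n
    ... | Bézout.+- x y 1+yn≡xa =
      subst (_∈ₛ H) (cong (dih false) (modN-cong (x * a) 1 xa≡1)) (r^-*-∈ a r^a∈ x)
      where
      xa≡1 : x * a ≡ 1 [mod suc m ]
      xa≡1 = trans (cong (_% suc m) (sym 1+yn≡xa)) ([m+kn]%n≡m%n 1 y (suc m))
    ... | Bézout.-+ x y 1+xa≡yn = r^-complement-∈ (x * a) 1 xa+1≡0 (r^-*-∈ a r^a∈ x)
      where
      xa+1≡0 : x * a + 1 ≡ 0 [mod suc m ]
      xa+1≡0 = trans (cong (_% suc m) (trans (+-comm (x * a) 1) 1+xa≡yn)) (m*n%n≡0 y (suc m))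

    r^∧sr^-∈ : ∀ a → r^ 1 ∈ₛ H → sr^ a ∈ₛ H → ∀ x → x ∈ₛ H
    r^∧sr^-∈ _ r∈ _ (dih false t) = subst (_∈ₛ H) (cong (dih false) (modN-toℕ t)) (r^-∈ r∈ (toℕ t))
    r^∧sr^-∈ a r∈ sr^a∈ (dih true t) =
      subst (_∈ₛ H) (trans (sr^-+ a k) (cong (dih true) (trans (modN-cong (a + k) (toℕ t) a+k≡t) (modN-toℕ t))))
            (mul-closed H _ _ sr^a∈ (r^-∈ r∈ k))
      where
      k : ℕ
      k = m * a + toℕ t
      a+k≡t : a + k ≡ toℕ t [mod suc m ]
      a+k≡t = trans (cong (_% suc m) (a+[m*a+t]≡t+a*n m a (toℕ t))) ([m+kn]%n≡m%n (toℕ t) a (suc m))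
        where
        a+[m*a+t]≡t+a*n : ∀ m a t → a + (m * a + t) ≡ t + a * suc m
        a+[m*a+t]≡t+a*n = solve-∀

    -- s r^a · s r^b = r^(negN a + b), a rotation by b − a.
    reflections-generate : ∀ a b → Coprime (negN (modN {m} a) + toℕ (modN {m} b)) (suc m) →
                           sr^ a ∈ₛ H → sr^ b ∈ₛ H → ∀ x → x ∈ₛ H
    reflections-generate a b b−a⊥n sr^a∈ sr^b∈ =
      r^∧sr^-∈ a (coprime-r^-∈ _ b−a⊥n (mul-closed H _ _ sr^a∈ sr^b∈)) sr^a∈

  rotations : Subgroup m
  rotations = record { mem = not ∘ Dih.refl? ; has-one = refl ; mul-closed = rotation-mul ; inv-closed = rotation-inv }
    where
    rotation-mul : ∀ x y → not (Dih.refl? x) ≡ true → not (Dih.refl? y) ≡ true → not (Dih.refl? (mul x y)) ≡ true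
    rotation-mul (dih false _) (dih false _) _ _ = refl
    rotation-mul (dih false _) (dih true _)  _ ()
    rotation-mul (dih true _)  _             ()
    rotation-inv : ∀ x → not (Dih.refl? x) ≡ true → not (Dih.refl? (inv x)) ≡ true
    rotation-inv (dih false _) _ = refl

  -- ⟨s r^k⟩ = {1, s r^k} is ⟨r^n, s r^k⟩, as r^n = 1.
  ⟨sr^_⟩ : ℕ → Subgroup m
  ⟨sr^_⟩ = ⟨r^d,sr^_⟩

  sr^∈⟨sr^⟩ : ∀ k → sr^ k ∈ₛ ⟨sr^ k ⟩
  sr^∈⟨sr^⟩ = sr^c∈

  ⟨sr^⟩-elements : ∀ {k} x → x ∈ₛ ⟨sr^ k ⟩ → x ≢ one → x ≡ sr^ k
  ⟨sr^⟩-elements {k} (dih false t) t≡0 t≢0 =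
    contradiction (cong (dih false) (trans (sym (modN-toℕ t)) (modN-cong (toℕ t) 0 (∈⇒Member k (dih false t) t≡0))))
                  t≢0
  ⟨sr^⟩-elements {k} (dih true t) t≡k _ =
    cong (dih true) (trans (sym (modN-toℕ t)) (modN-cong (toℕ t) k (∈⇒Member k (dih true t) t≡k)))

module _ {m : ℕ} where

  Distinct-irrefl : ∀ {u : Vertex m} → ¬ Distinct u u
  Distinct-irrefl (_ , x≢x) = x≢x refl

  Distinct-sym : ∀ {u v : Vertex m} → Distinct u v → Distinct v u
  Distinct-sym (x , x≢) = x , x≢ ∘ sym

  ∉∈⇒Distinct : ∀ {u v : Vertex m} x → ¬ x ∈ₛ proj₁ u → x ∈ₛ proj₁ v → Distinct u v
  ∉∈⇒Distinct x x∉u x∈v = x , λ eq → x∉u (trans eq x∈v)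

  ⊆∧⊇⇒¬Distinct : ∀ {u v : Vertex m} → proj₁ u ⊆ₛ proj₁ v → proj₁ v ⊆ₛ proj₁ u → ¬ Distinct u v
  ⊆∧⊇⇒¬Distinct {u} {v} u⊆v v⊆u (x , x≢) with mem (proj₁ u) x in x∈u | mem (proj₁ v) x in x∈v
  ... | true  | true  = x≢ refl
  ... | false | false = x≢ refl
  ... | true  | false = contradiction (trans (sym (u⊆v x x∈u)) x∈v) λ ()
  ... | false | true  = contradiction (trans (sym (v⊆u x x∈v)) x∈u) λ ()

  Adjacent-sym : ∀ {u v : Vertex m} → Adjacent u v → Adjacent v u
  Adjacent-sym {u} {v} (u≢v , x , x≢1 , x∈u , x∈v) = Distinct-sym {u} {v} u≢v , x , x≢1 , x∈v , x∈u

  Adjacent⇒Dist1 : ∀ {u v : Vertex m} → Adjacent u v → Dist u v 1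
  Adjacent⇒Dist1 {u} {v} u~v = step {w = v} u~v here , lower
    where
    lower : ∀ j → Walk u v j → 1 ≤ j
    lower 0 here    = contradiction (proj₁ u~v) (Distinct-irrefl {u})
    lower (suc _) _ = s≤s z≤n

  common-neighbour⇒Dist2 : ∀ {u v w : Vertex m} → Distinct u v → ¬ Adjacent u v →
                           Adjacent u w → Adjacent w v → Dist u v 2
  common-neighbour⇒Dist2 {u} {v} {w} u≢v u≁v u~w w~v = step {w = w} u~w (step {w = v} w~v here) , lower
    where
    lower : ∀ j → Walk u v j → 2 ≤ j
    lower 0 here                = contradiction u≢v (Distinct-irrefl {u})
    lower 1 (step u~v here)     = contradiction u~v u≁v
    lower (suc (suc _)) _       = s≤s (s≤s z≤n)

  path3⇒Dist3 : ∀ {u v w₁ w₂ : Vertex m} → Distinct u v → ¬ Adjacent u v →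
                (∀ {w} → Adjacent u w → ¬ Adjacent w v) →
                Adjacent u w₁ → Adjacent w₁ w₂ → Adjacent w₂ v → Dist u v 3
  path3⇒Dist3 {u} {v} {w₁} {w₂} u≢v u≁v no-common u~w₁ w₁~w₂ w₂~v =
    step {w = w₁} u~w₁ (step {w = w₂} w₁~w₂ (step {w = v} w₂~v here)) , lower
    where
    lower : ∀ j → Walk u v j → 3 ≤ j
    lower 0 here                     = contradiction u≢v (Distinct-irrefl {u})
    lower 1 (step u~v here)          = contradiction u~v u≁v
    lower 2 (step {w = w} u~w (step w~v here)) = contradiction w~v (no-common {w} u~w)
    lower (suc (suc (suc _))) _      = s≤s (s≤s (s≤s z≤n))

module IntersectionGraph (p m : ℕ) (p-prime : Prime p) (n≡p*p : suc m ≡ p * p) where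

  private instance
    p-nonZero : NonZero p
    p-nonZero = prime⇒nonZero p-prime

  1<p : 1 < p
  1<p = nonTrivial⇒n>1 p {{prime⇒nonTrivial p-prime}}

  open Residues {m} p (divides p n≡p*p)
    renaming (⟨r^d,sr^_⟩ to ⟨r^p,sr^_⟩; r^d∈ to r^p∈)

  r^p≢one : r^ {m} p ≢ one
  r^p≢one r^p≡1 = n>0⇒n≢0 (≤-trans (s≤s z≤n) 1<p) (begin
    p                         ≡⟨ m<n⇒m%n≡m p<n ⟨
    p % suc m                 ≡⟨ toℕ-fromℕ< _ ⟨
    toℕ (Dih.rot (r^ {m} p))  ≡⟨ cong (toℕ ∘ Dih.rot) r^p≡1 ⟩
    0                         ∎)
    where
    open ≡-Reasoning
    p<n : p < suc m
    p<n = subst (p <_) (sym n≡p*p) (m<m*n p p 1<p)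

  Hₚ : ℕ → Vertex m
  Hₚ c = ⟨r^p,sr^ c ⟩ , (r^ 1 , r^1∉) , (sr^ c , (λ ()) , sr^c∈ c)
    where
    r^1∉ : ¬ r^ 1 ∈ₛ ⟨r^p,sr^ c ⟩
    r^1∉ r^1∈ = n>0⇒n≢0 (s≤s z≤n)
      (trans (sym (m<n⇒m%n≡m 1<p)) (trans (sym (toℕ-modN-mod 1)) (trans (∈⇒Member c (r^ 1) r^1∈) (m*n%n≡0 0 p))))

  module Hᵢ-vertex (i : ℕ) (u : Vertex m) (u∈Hᵢ : InH p i u) where

    generator : ℕ
    generator = i + proj₁ u∈Hᵢ * p

    private
      generation : IsGeneratedBy (proj₁ u) (sr^ generator ∷ [])
      generation = proj₂ (proj₂ (proj₂ u∈Hᵢ))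

    generator≡i : generator ≡ i [mod p ]
    generator≡i = [m+kn]%n≡m%n i (proj₁ u∈Hᵢ) p

    generator∈ : sr^ generator ∈ₛ proj₁ u
    generator∈ = head (proj₁ generation)

    ⊆-any : ∀ K → sr^ generator ∈ₛ K → proj₁ u ⊆ₛ K
    ⊆-any K g∈K = proj₂ generation K (g∈K ∷ [])

    nonidentity≡generator : ∀ x → x ∈ₛ proj₁ u → x ≢ one → x ≡ sr^ generator
    nonidentity≡generator x x∈u = ⟨sr^⟩-elements x (⊆-any ⟨sr^ generator ⟩ (sr^∈⟨sr^⟩ generator) x x∈u)

    nonidentity∈⇒generator∈ : ∀ H x → x ≢ one → x ∈ₛ proj₁ u → x ∈ₛ H → sr^ generator ∈ₛ H
    nonidentity∈⇒generator∈ H x x≢1 x∈u = subst (_∈ₛ H) (nonidentity≡generator x x∈u x≢1)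

    r^p∉ : ¬ r^ p ∈ₛ proj₁ u
    r^p∉ r^p∈u with nonidentity≡generator (r^ p) r^p∈u r^p≢one
    ... | ()

    ~Hₚ : Adjacent u (Hₚ i)
    ~Hₚ = ∉∈⇒Distinct {u = u} {v = Hₚ i} (r^ p) r^p∉ (r^p∈ i) , sr^ generator , (λ ()) , generator∈ ,
          Member⇒∈ i (sr^ generator) (trans (toℕ-modN-mod generator) generator≡i)

  module Hₚⁱ-vertex (i : ℕ) (v : Vertex m) (v≡Hₚⁱ : IsHp p i v) where

    r^p∈v : r^ p ∈ₛ proj₁ v
    r^p∈v = head (proj₁ v≡Hₚⁱ)

    ⊆Hₚ : proj₁ v ⊆ₛ ⟨r^p,sr^ i ⟩
    ⊆Hₚ = proj₂ v≡Hₚⁱ ⟨r^p,sr^ i ⟩ (r^p∈ i ∷ sr^c∈ i ∷ [])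

    sr^[i+lp]∈ : ∀ l → sr^ (i + l * p) ∈ₛ proj₁ v
    sr^[i+lp]∈ l with _ ∷ sr^i∈v ∷ [] ← proj₁ v≡Hₚⁱ =
      subst (_∈ₛ proj₁ v) (sr^-+ i (l * p)) (mul-closed (proj₁ v) _ _ sr^i∈v (r^-*-∈ (proj₁ v) p r^p∈v l))

  H₁ₚ⇒r^p∈ : ∀ (v : Vertex m) → InH1p p v → r^ p ∈ₛ proj₁ v
  H₁ₚ⇒r^p∈ v (inj₁ (r∈ ∷ [] , _))   = r^-∈ (proj₁ v) r∈ p
  H₁ₚ⇒r^p∈ v (inj₂ (r^p∈ ∷ [] , _)) = r^p∈

  H₁ₚ⇒⊆rotations : ∀ (v : Vertex m) → InH1p p v → proj₁ v ⊆ₛ rotations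
  H₁ₚ⇒⊆rotations v (inj₁ (_ , least)) = least rotations (refl ∷ [])
  H₁ₚ⇒⊆rotations v (inj₂ (_ , least)) = least rotations (refl ∷ [])

  InA⇒r^p∈ : ∀ (v : Vertex m) → InA p v → r^ p ∈ₛ proj₁ v
  InA⇒r^p∈ v (inj₁ v∈H₁ₚ)              = H₁ₚ⇒r^p∈ v v∈H₁ₚ
  InA⇒r^p∈ v (inj₂ (i , _ , _ , v≡Hₚⁱ)) = Hₚⁱ-vertex.r^p∈v i v v≡Hₚⁱ

  Hₚ~ : ∀ j (v : Vertex m) → r^ p ∈ₛ proj₁ v → ¬ sr^ j ∈ₛ proj₁ v → Adjacent (Hₚ j) v
  Hₚ~ j v r^p∈v sr^j∉v =
    Distinct-sym {u = v} {v = Hₚ j} (∉∈⇒Distinct {u = v} {v = Hₚ j} (sr^ j) sr^j∉v (sr^c∈ j)) ,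
    r^ p , r^p≢one , r^p∈ j , r^p∈v

  module _ (u v : Vertex m) (u≢v : Distinct u v) where

    dist-A-A : InA p u → InA p v → Dist u v 1
    dist-A-A u∈A v∈A = Adjacent⇒Dist1 (u≢v , r^ p , r^p≢one , InA⇒r^p∈ u u∈A , InA⇒r^p∈ v v∈A)

    dist-Hᵢ-Hₚⁱ : ∀ i → InH p i u → IsHp p i v → Dist u v 1
    dist-Hᵢ-Hₚⁱ i u∈Hᵢ v≡Hₚⁱ = Adjacent⇒Dist1
      (u≢v , sr^ U.generator , (λ ()) , U.generator∈ , Hₚⁱ-vertex.sr^[i+lp]∈ i v v≡Hₚⁱ (proj₁ u∈Hᵢ))
      where module U = Hᵢ-vertex i u u∈Hᵢ

    dist-Hᵢ-Hᵢ : ∀ i → InH p i u → InH p i v → Dist u v 2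
    dist-Hᵢ-Hᵢ i u∈Hᵢ v∈Hᵢ =
      common-neighbour⇒Dist2 {w = Hₚ i} u≢v u≁v U.~Hₚ (Adjacent-sym {u = v} {v = Hₚ i} V.~Hₚ)
      where
      module U = Hᵢ-vertex i u u∈Hᵢ
      module V = Hᵢ-vertex i v v∈Hᵢ
      u≁v : ¬ Adjacent u v
      u≁v (_ , x , x≢1 , x∈u , x∈v) = ⊆∧⊇⇒¬Distinct {u = u} {v = v}
        (U.⊆-any (proj₁ v) (U.nonidentity∈⇒generator∈ (proj₁ v) x x≢1 x∈u x∈v))
        (V.⊆-any (proj₁ u) (V.nonidentity∈⇒generator∈ (proj₁ u) x x≢1 x∈v x∈u))
        u≢v

    dist-Hⱼ-H₁ₚ : ∀ j → InH p j u → InH1p p v → Dist u v 2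
    dist-Hⱼ-H₁ₚ j u∈Hⱼ v∈H₁ₚ =
      common-neighbour⇒Dist2 {w = Hₚ j} u≢v u≁v U.~Hₚ (Hₚ~ j v (H₁ₚ⇒r^p∈ v v∈H₁ₚ) sr^j∉v)
      where
      module U = Hᵢ-vertex j u u∈Hⱼ
      v⊆rotations : proj₁ v ⊆ₛ rotations
      v⊆rotations = H₁ₚ⇒⊆rotations v v∈H₁ₚ
      sr^j∉v : ¬ sr^ j ∈ₛ proj₁ v
      sr^j∉v sr^j∈v with v⊆rotations _ sr^j∈v
      ... | ()
      u≁v : ¬ Adjacent u v
      u≁v (_ , x , x≢1 , x∈u , x∈v)
        with v⊆rotations _ (U.nonidentity∈⇒generator∈ (proj₁ v) x x≢1 x∈u x∈v)
      ... | ()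

    module _ {i j} (1≤i : 1 ≤ i) (i≤p : i ≤ p) (1≤j : 1 ≤ j) (j≤p : j ≤ p) (i≢j : i ≢ j) where

      private
        i≢j[mod] : ¬ i ≡ j [mod p ]
        i≢j[mod] = i≢j ∘ ≡[mod]-injective 1≤i i≤p 1≤j j≤p

      dist-Hⱼ-Hₚⁱ : InH p j u → IsHp p i v → Dist u v 2
      dist-Hⱼ-Hₚⁱ u∈Hⱼ v≡Hₚⁱ =
        common-neighbour⇒Dist2 {w = Hₚ j} u≢v u≁v U.~Hₚ (Hₚ~ j v V.r^p∈v sr^j∉v)
        where
        module U = Hᵢ-vertex j u u∈Hⱼ
        module V = Hₚⁱ-vertex i v v≡Hₚⁱ
        sr^j∉v : ¬ sr^ j ∈ₛ proj₁ v
        sr^j∉v sr^j∈v = i≢j[mod] (sym (sr^∈⇒≡ i j (V.⊆Hₚ _ sr^j∈v)))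
        u≁v : ¬ Adjacent u v
        u≁v (_ , x , x≢1 , x∈u , x∈v) = i≢j[mod]
          (trans (sym (sr^∈⇒≡ i _ (V.⊆Hₚ _ (U.nonidentity∈⇒generator∈ (proj₁ v) x x≢1 x∈u x∈v))))
                 U.generator≡i)

      dist-Hᵢ-Hⱼ : InH p i u → InH p j v → Dist u v 3
      dist-Hᵢ-Hⱼ u∈Hᵢ v∈Hⱼ =
        path3⇒Dist3 {w₁ = Hₚ i} {w₂ = Hₚ j} u≢v u≁v (λ {w} → no-common-neighbour {w})
          U.~Hₚ (Hₚ~ i (Hₚ j) (r^p∈ j) (i≢j[mod] ∘ sr^∈⇒≡ j i)) (Adjacent-sym {u = v} {v = Hₚ j} V.~Hₚ)
        where
        module U = Hᵢ-vertex i u u∈Hᵢ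
        module V = Hᵢ-vertex j v v∈Hⱼ
        a b : ℕ
        a = U.generator
        b = V.generator
        generators≡⇒i≡j : toℕ (modN {m} a) ≡ toℕ (modN {m} b) [mod p ] → i ≡ j [mod p ]
        generators≡⇒i≡j a≡b = trans (sym U.generator≡i) (trans (sym (toℕ-modN-mod a))
                         (trans a≡b (trans (toℕ-modN-mod b) V.generator≡i)))
        u≁v : ¬ Adjacent u v
        u≁v (_ , x , x≢1 , x∈u , x∈v) = i≢j[mod] (generators≡⇒i≡j (cong (λ y → toℕ (Dih.rot y) % p)
          (trans (sym (U.nonidentity≡generator x x∈u x≢1)) (V.nonidentity≡generator x x∈v x≢1))))
        b−a : ℕ
        b−a = negN (modN {m} a) + toℕ (modN {m} b)
        b−a⊥n : Coprime b−a (suc m)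
        b−a⊥n = coprime-sym (subst (λ n → Coprime n b−a) (sym n≡p*p) (coprime-*ˡ p⊥ p⊥))
          where
          p⊥ : Coprime p b−a
          p⊥ = prime∤⇒coprime p-prime
                 (i≢j[mod] ∘ generators≡⇒i≡j ∘ negN-+-mod0⇒≡ (modN a) (modN b) ∘ ∣⇒≡0[mod] {x = b−a})
        no-common-neighbour : ∀ {w} → Adjacent u w → ¬ Adjacent w v
        no-common-neighbour {w} (_ , x , x≢1 , x∈u , x∈w) (_ , y , y≢1 , y∈w , y∈v)
          with proj₁ (proj₂ w)
        ... | z , z∉w = z∉w (reflections-generate (proj₁ w) a b b−a⊥n
                        (U.nonidentity∈⇒generator∈ (proj₁ w) x x≢1 x∈u x∈w)
                        (V.nonidentity∈⇒generator∈ (proj₁ w) y y≢1 y∈v y∈w) z)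

corollary2p5 : (p m : ℕ) → Prime p → suc m ≡ p * p → (u v : Vertex m) → Distinct u v →
    ((InA p u → InA p v → Dist u v 1)
    × (∀ i → 1 ≤ i → i ≤ p → InH p i u → IsHp p i v → Dist u v 1))
    × ((∀ i → 1 ≤ i → i ≤ p → InH p i u → InH p i v → Dist u v 2)
    × (∀ j → 1 ≤ j → j ≤ p → InH p j u → InH1p p v → Dist u v 2)
    × (∀ i j → 1 ≤ i → i ≤ p → 1 ≤ j → j ≤ p → i ≢ j → InH p j u → IsHp p i v → Dist u v 2))
    × (∀ i j → 1 ≤ i → i ≤ p → 1 ≤ j → j ≤ p → i ≢ j → InH p i u → InH p j v → Dist u v 3)
corollary2p5 p m p-prime n≡p*p u v u≢v =
  ( dist-A-A u v u≢v
  , (λ i _ _ → dist-Hᵢ-Hₚⁱ u v u≢v i))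
  , ( (λ i _ _ → dist-Hᵢ-Hᵢ u v u≢v i)
    , (λ j _ _ → dist-Hⱼ-H₁ₚ u v u≢v j)
    , (λ i j 1≤i i≤p 1≤j j≤p i≢j → dist-Hⱼ-Hₚⁱ u v u≢v 1≤i i≤p 1≤j j≤p i≢j))
  , (λ i j 1≤i i≤p 1≤j j≤p i≢j → dist-Hᵢ-Hⱼ u v u≢v 1≤i i≤p 1≤j j≤p i≢j)
  where open IntersectionGraph p m p-prime n≡p*p
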